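{- Let $x_0=(y_0,m_0,d_0)\in G_0$ and let $r_2=\#\{z\in G_0: (y_0,3,0)\le z<x_0\}$ be its day of the year. Set $n_3=5\cdot r_2+461$, $q_3=n_3/153$ and $r_3=n_3\%153/5$. Then $q_3=m_0$ and $r_3=d_0$.
   Context: For $n,\delta\in\mathbb{Z}$ with $\delta\neq0$, $n/\delta$ and $n\%\delta$ denote Euclidean quotient and remainder ($n=q\delta+s$, $0\le s<|\delta|$); $\cdot$, $/$, $\%$ have equal precedence and associate left to right. $\mathbb{Z}^3$ carries the lexicographic order. A year $y$ is a leap year if ($y\%4=0$ and $y\%100\ne0$) or $y\%400=0$. The Gregorian calendar is $G=\{(y,m,d)\in\mathbb{Z}^3: m\in\{1,\dots,12\},\ 1\le d\le L(y,m)\}$ where $L(y,m)=31$ for $m\in\{1,3,5,7,8,10,12\}$, $L(y,m)=30$ for $m\in\{4,6,9,11\}$, and $L(y,2)=29$ if $y$ is a leap year and $28$ otherwise. Let $P_1:\mathbb{Z}^3\to\mathbb{Z}^3$, $P_1(y,m,d)=(y-\mathbf 1_{\{m\le2\}},\ m+12\cdot\mathbf 1_{\{m\le2\}},\ d-1)$, where $\mathbf 1_{\{P\}}$ is $1$ if $P$ holds and $0$ otherwise. The computational calendar is $G_0=\{P_1(x): x\in G,\ P_1(x)\ge (0,3,0)\}$. -}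

module Defs where

open import Data.Bool using (Bool; true; false; if_then_else_; _∧_; _∨_; not)
open import Data.Integer using (ℤ; +_; _+_; _-_; _*_; _<_; _≤_; _≤ᵇ_; _/_; _%_)
open import Data.Integer.Properties using (_≟_)
open import Data.Nat using (ℕ)
import Data.Nat as ℕ
open import Data.Product using (Σ; _×_; _,_)
open import Data.Sum using (_⊎_)
open import Relation.Binary.PropositionalEquality using (_≡_; _≢_)
open import Relation.Nullary.Decidable using (⌊_⌋)

Date : Set
Date = ℤ × ℤ × ℤ

_<ₗ_ : Date → Date → Set
(y , m , d) <ₗ (y' , m' , d') =
  (y < y') ⊎ ((y ≡ y') × ((m < m') ⊎ ((m ≡ m') × (d < d'))))

_≤ₗ_ : Date → Date → Set
x ≤ₗ x' = (x <ₗ x') ⊎ (x ≡ x')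

infix 4 _==_
_==_ : ℤ → ℤ → Bool
a == b = ⌊ a ≟ b ⌋

isLeap : ℤ → Bool
isLeap y = (((y % + 4) ℕ.≡ᵇ 0) ∧ not ((y % + 100) ℕ.≡ᵇ 0)) ∨ ((y % + 400) ℕ.≡ᵇ 0)

-- Month lengths L(y,m) (only meaningful for m ∈ {1,…,12})
L : ℤ → ℤ → ℤ
L y m =
  if (m == + 1) ∨ (m == + 3) ∨ (m == + 5) ∨ (m == + 7) ∨ (m == + 8) ∨ (m == + 10) ∨ (m == + 12)
  then + 31
  else if (m == + 4) ∨ (m == + 6) ∨ (m == + 9) ∨ (m == + 11)
  then + 30
  else if isLeap y then + 29 else + 28

InG : Date → Set
InG (y , m , d) = (+ 1 ≤ m) × (m ≤ + 12) × (+ 1 ≤ d) × (d ≤ L y m)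

P₁ : Date → Date
P₁ (y , m , d) =
  if m ≤ᵇ + 2 then (y - + 1 , m + + 12 , d - + 1) else (y , m , d - + 1)

InG₀ : Date → Set
InG₀ z = Σ Date (λ x → InG x × (P₁ x ≡ z)) × ((+ 0 , + 3 , + 0) ≤ₗ z)

{-# OPTIONS --safe #-}
-- In the computational year (months 3, …, 14 for March, …, February, days counted from 0)
-- the date (m , d) is day number daysBefore m + d, and k ↦ ((5k+461)/153, (5k+461)%153/5)
-- inverts this numbering and is strictly increasing on 0, …, 365; these are finite facts,
-- checked by evaluation. Every index below 365 decodes to a date before 29 February, which
-- exists in every year, so the dates of G₀ between 1 March of y₀ and x₀ are exactly the
-- images of the indices below the day number of x₀. Counting them gives that day number,
-- and the formula decodes it back to (m₀ , d₀).
module Submission where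

module DayOfYear where

  open import Data.Bool using (Bool; true; false; T; if_then_else_; _∧_)
  open import Data.Bool.Properties using (T-∧)
  open import Data.Empty using (⊥-elim)
  open import Data.Nat using (ℕ; suc; s≤s; s≤s⁻¹; _+_; _*_; _/_; _%_; _≤_; _<_; _≤ᵇ_)
  open import Data.Product using (_×_; _,_; proj₁; proj₂)
  open import Data.Sum using (inj₁; inj₂)
  open import Function using (_∘_)
  open import Function.Bundles using (Equivalence)
  open import Relation.Binary.PropositionalEquality using (_≡_; refl; sym; trans; cong; subst; subst₂)
  open import Data.Nat.Properties
    using (_≟_; _≤?_; _<?_; ≤ᵇ⇒≤; <⇒≤; m≤n⇒m<n∨m≡n; <-cmp; <-strictPartialOrder; allUpTo?)
  open import Data.Product.Properties using (≡-dec)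
  open import Data.Product.Relation.Binary.Lex.Strict using (×-Lex; ×-strictPartialOrder; ×-decidable)
  open import Relation.Binary using (Rel; StrictPartialOrder; tri<; tri≈; tri>)
  open import Relation.Nullary using (¬_; Dec)
  open import Relation.Nullary.Decidable using (toWitness; _×-dec_; _→-dec_)

  daysBefore : ℕ → ℕ
  daysBefore 4  = 31
  daysBefore 5  = 61
  daysBefore 6  = 92
  daysBefore 7  = 122
  daysBefore 8  = 153
  daysBefore 9  = 184
  daysBefore 10 = 214
  daysBefore 11 = 245
  daysBefore 12 = 275
  daysBefore 13 = 306
  daysBefore 14 = 337
  daysBefore _  = 0

  monthLength : Bool → ℕ → ℕ
  monthLength leap 14 = if leap then 29 else 28
  monthLength _    4  = 30
  monthLength _    6  = 30
  monthLength _    9  = 30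
  monthLength _    11 = 30
  monthLength _    _  = 31

  InYear : Bool → ℕ × ℕ → Set
  InYear leap (m , d) = (3 ≤ m × m ≤ 14) × d < monthLength leap m

  inYear : ∀ leap m {d} {_ : T ((3 ≤ᵇ m) ∧ (m ≤ᵇ 14))} → d < monthLength leap m → InYear leap (m , d)
  inYear _ m {_} {range} d< with Equivalence.to T-∧ range
  ... | 3≤m , m≤14 = (≤ᵇ⇒≤ 3 m 3≤m , ≤ᵇ⇒≤ m 14 m≤14) , d<

  inYear? : ∀ leap p → Dec (InYear leap p)
  inYear? leap (m , d) = (3 ≤? m ×-dec m ≤? 14) ×-dec d <? monthLength leap m

  dayOfYear : ℕ × ℕ → ℕ
  dayOfYear (m , d) = daysBefore m + d

  monthOf : ℕ → ℕ
  monthOf k = (5 * k + 461) / 153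

  dayOf : ℕ → ℕ
  dayOf k = (5 * k + 461) % 153 / 5

  decode : ℕ → ℕ × ℕ
  decode k = monthOf k , dayOf k

  infix 4 _≺_
  _≺_ : Rel (ℕ × ℕ) _
  _≺_ = ×-Lex _≡_ _<_ _<_

  ≺-strictPartialOrder : StrictPartialOrder _ _ _
  ≺-strictPartialOrder = ×-strictPartialOrder <-strictPartialOrder <-strictPartialOrder

  open StrictPartialOrder ≺-strictPartialOrder using () renaming (trans to ≺-trans)

  ≺-irrefl : ∀ {p} → ¬ p ≺ p
  ≺-irrefl = StrictPartialOrder.irrefl ≺-strictPartialOrder (refl , refl)

  DecodesBack : ℕ × ℕ → Set
  DecodesBack p = decode (dayOfYear p) ≡ p × dayOfYear p ≤ 365

  decodesBack-table : ∀ {m} → m < 15 → 3 ≤ m → ∀ {d} → d < monthLength true m → DecodesBack (m , d)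
  decodesBack-table = toWitness {a? = allUpTo? month? 15} _
    where
    month? : ∀ m → Dec (3 ≤ m → ∀ {d} → d < monthLength true m → DecodesBack (m , d))
    month? m = 3 ≤? m →-dec allUpTo? (λ d → ≡-dec _≟_ _≟_ (decode (dayOfYear (m , d))) (m , d)
                                           ×-dec dayOfYear (m , d) ≤? 365) (monthLength true m)

  decode-dayOfYear : ∀ {p} → InYear true p → decode (dayOfYear p) ≡ p
  decode-dayOfYear ((3≤m , m≤14) , d<) = proj₁ (decodesBack-table (s≤s m≤14) 3≤m d<)

  dayOfYear≤365 : ∀ {p} → InYear true p → dayOfYear p ≤ 365
  dayOfYear≤365 ((3≤m , m≤14) , d<) = proj₂ (decodesBack-table (s≤s m≤14) 3≤m d<)

  decode-inYear : ∀ {k} → k < 365 → InYear false (decode k)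
  decode-inYear = toWitness {a? = allUpTo? (inYear? false ∘ decode) 365} _

  decode-≺-suc : ∀ {k} → k < 365 → decode k ≺ decode (suc k)
  decode-≺-suc = toWitness {a? = allUpTo? (λ k → ×-decidable _≟_ _<?_ _<?_ (decode k) (decode (suc k))) 365} _

  decode-strictMono : ∀ {i j} → i < j → j ≤ 365 → decode i ≺ decode j
  decode-strictMono {i} {suc j} i<1+j 1+j≤365 with m≤n⇒m<n∨m≡n (s≤s⁻¹ i<1+j)
  ... | inj₁ i<j  = ≺-trans (decode-strictMono i<j (<⇒≤ 1+j≤365)) (decode-≺-suc 1+j≤365)
  ... | inj₂ refl = decode-≺-suc 1+j≤365

  dayOfYear-strictMono : ∀ {p q} → InYear true p → InYear true q → p ≺ q → dayOfYear p < dayOfYear q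
  dayOfYear-strictMono {p} {q} p∈ q∈ p≺q with <-cmp (dayOfYear p) (dayOfYear q)
  ... | tri< p<q _ _ = p<q
  ... | tri≈ _ same-day _ = ⊥-elim (≺-irrefl (subst (_≺ q) p≡q p≺q))
    where
    p≡q : p ≡ q
    p≡q = trans (sym (decode-dayOfYear p∈)) (trans (cong decode same-day) (decode-dayOfYear q∈))
  ... | tri> _ _ q<p = ⊥-elim (≺-irrefl (≺-trans p≺q q≺p))
    where
    q≺p : q ≺ p
    q≺p = subst₂ _≺_ (decode-dayOfYear q∈) (decode-dayOfYear p∈) (decode-strictMono q<p (dayOfYear≤365 p∈))

open import Defs
open import Data.Integer using (ℤ; +_; _+_; _*_; _/_; _%_)
open import Data.List using (List; length)
open import Data.List.Membership.Propositional using (_∈_)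
open import Data.List.Relation.Unary.Unique.Propositional using (Unique)
open import Data.Product using (_×_; _,_)
open import Function.Bundles using (_⇔_)
open import Relation.Binary.PropositionalEquality using (_≡_)

open import Data.Bool using (true; false; T; _∧_)
open import Data.Bool.Properties using (T-∧)
open import Data.Empty using (⊥-elim)
open import Data.Integer as ℤ using (-[1+_]; +≤+; +<+)
open import Data.Integer.DivMod using (div-pos-is-/ℕ)
open import Data.Integer.Properties using (+-injective; pos-*; <-asym; <-irrefl)
open import Data.List using (applyUpTo)
open import Data.List.Membership.Propositional.Properties using (∈-applyUpTo⁺; ∈-applyUpTo⁻)
open import Data.List.Membership.Propositional.Properties.WithK using (unique∧set⇒bag)
open import Data.List.Properties using (length-applyUpTo)
open import Data.List.Relation.Binary.BagAndSetEquality using (∼bag⇒↭)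
open import Data.List.Relation.Binary.Permutation.Propositional.Properties using (↭-length)
open import Data.List.Relation.Unary.AllPairs.Properties using (applyUpTo⁺₁)
open import Data.Nat as ℕ using (ℕ; zero; suc; z≤n; s≤s; s≤s⁻¹; z<s)
open import Data.Nat.Properties using (m≤n⇒m≤1+n; m≤n⇒m<n∨m≡n; <-≤-trans; ≤ᵇ⇒≤; 1+n≰n; m+n≤o⇒m≤o)
open import Data.Product using (proj₁; proj₂; ∃-syntax)
open import Data.Sum using (inj₁; inj₂)
open import Function using (_∘_)
open import Function.Bundles using (Equivalence; mk⇔)
open import Function.Properties.Equivalence using () renaming (trans to ⇔-trans; sym to ⇔-sym)
open import Relation.Binary.PropositionalEquality using (_≢_; refl; sym; trans; cong; subst; module ≡-Reasoning)

open DayOfYear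

length-unique-⇔ : ∀ {A : Set} {xs ys : List A} → Unique xs → Unique ys →
                  (∀ z → (z ∈ xs) ⇔ (z ∈ ys)) → length xs ≡ length ys
length-unique-⇔ unique-xs unique-ys xs⇔ys = ↭-length (∼bag⇒↭ (unique∧set⇒bag unique-xs unique-ys (λ {z} → xs⇔ys z)))

day : ℤ → ℕ × ℕ → Date
day y p = y , + proj₁ p , + proj₂ p

day-injective : ∀ {y p q} → day y p ≡ day y q → p ≡ q
day-injective refl = refl

InG-intro : ∀ y b {c} {_ : T ((1 ℕ.≤ᵇ b) ∧ (b ℕ.≤ᵇ 12))} → + suc c ℤ.≤ L y (+ b) → InG (y , + b , + suc c)
InG-intro _ b {_} {range} c< with Equivalence.to T-∧ range
... | 1≤b , b≤12 = +≤+ (≤ᵇ⇒≤ 1 b 1≤b) , +≤+ (≤ᵇ⇒≤ b 12 b≤12) , +≤+ (s≤s z≤n) , c<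

P₁-inYear : ∀ a b c → 1 ℕ.≤ b → b ℕ.≤ 12 → + suc c ℤ.≤ L a (+ b) →
            ∃[ y ] ∃[ p ] InYear true p × P₁ (a , + b , + suc c) ≡ day y p
P₁-inYear a 0  c () _ _
P₁-inYear a 1  c _ _ (+≤+ c<) = _ , (13 , c) , inYear true 13 c< , refl
P₁-inYear a 2  c _ _ c<L with isLeap a
P₁-inYear a 2  c _ _ (+≤+ c<) | true  = _ , (14 , c) , inYear true 14 c< , refl
P₁-inYear a 2  c _ _ (+≤+ c<) | false = _ , (14 , c) , inYear true 14 (m≤n⇒m≤1+n c<) , refl
P₁-inYear a 3  c _ _ (+≤+ c<) = _ , (3 , c) , inYear true 3 c< , refl
P₁-inYear a 4  c _ _ (+≤+ c<) = _ , (4 , c) , inYear true 4 c< , refl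
P₁-inYear a 5  c _ _ (+≤+ c<) = _ , (5 , c) , inYear true 5 c< , refl
P₁-inYear a 6  c _ _ (+≤+ c<) = _ , (6 , c) , inYear true 6 c< , refl
P₁-inYear a 7  c _ _ (+≤+ c<) = _ , (7 , c) , inYear true 7 c< , refl
P₁-inYear a 8  c _ _ (+≤+ c<) = _ , (8 , c) , inYear true 8 c< , refl
P₁-inYear a 9  c _ _ (+≤+ c<) = _ , (9 , c) , inYear true 9 c< , refl
P₁-inYear a 10 c _ _ (+≤+ c<) = _ , (10 , c) , inYear true 10 c< , refl
P₁-inYear a 11 c _ _ (+≤+ c<) = _ , (11 , c) , inYear true 11 c< , refl
P₁-inYear a 12 c _ _ (+≤+ c<) = _ , (12 , c) , inYear true 12 c< , refl
P₁-inYear a (suc (suc (suc (suc (suc (suc (suc (suc (suc (suc (suc (suc (suc _))))))))))))) c _ b≤12 _ =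
  ⊥-elim (1+n≰n (m+n≤o⇒m≤o 13 b≤12))

InG₀⇒inYear : ∀ {y m d} → InG₀ (y , m , d) → ∃[ p ] InYear true p × (y , m , d) ≡ day y p
InG₀⇒inYear (((a , -[1+ _ ] , _) , (() , _) , _) , _)
InG₀⇒inYear (((a , + b , -[1+ _ ]) , (_ , _ , () , _) , _) , _)
InG₀⇒inYear (((a , + b , + zero) , (_ , _ , +≤+ () , _) , _) , _)
InG₀⇒inYear (((a , + b , + suc c) , (+≤+ 1≤b , +≤+ b≤12 , _ , c<L) , P₁x≡z) , _)
  with P₁-inYear a b c 1≤b b≤12 c<L
... | y , p , p∈ , P₁x≡day with trans (sym P₁x≡z) P₁x≡day
... | refl = p , p∈ , refl

inYear⇒InG : ∀ k p → InYear false p → ∃[ x ] InG x × P₁ x ≡ day (+ k) p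
inYear⇒InG k (0  , _) ((() , _) , _)
inYear⇒InG k (1  , _) ((s≤s () , _) , _)
inYear⇒InG k (2  , _) ((s≤s (s≤s ()) , _) , _)
inYear⇒InG k (3  , d) (_ , d<) = _ , InG-intro (+ k) 3 (+≤+ d<) , refl
inYear⇒InG k (4  , d) (_ , d<) = _ , InG-intro (+ k) 4 (+≤+ d<) , refl
inYear⇒InG k (5  , d) (_ , d<) = _ , InG-intro (+ k) 5 (+≤+ d<) , refl
inYear⇒InG k (6  , d) (_ , d<) = _ , InG-intro (+ k) 6 (+≤+ d<) , refl
inYear⇒InG k (7  , d) (_ , d<) = _ , InG-intro (+ k) 7 (+≤+ d<) , refl
inYear⇒InG k (8  , d) (_ , d<) = _ , InG-intro (+ k) 8 (+≤+ d<) , refl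
inYear⇒InG k (9  , d) (_ , d<) = _ , InG-intro (+ k) 9 (+≤+ d<) , refl
inYear⇒InG k (10 , d) (_ , d<) = _ , InG-intro (+ k) 10 (+≤+ d<) , refl
inYear⇒InG k (11 , d) (_ , d<) = _ , InG-intro (+ k) 11 (+≤+ d<) , refl
inYear⇒InG k (12 , d) (_ , d<) = _ , InG-intro (+ k) 12 (+≤+ d<) , refl
inYear⇒InG k (13 , d) (_ , d<) = (+ suc k , + 1 , + suc d) , InG-intro (+ suc k) 1 (+≤+ d<) , refl
inYear⇒InG k (14 , d) (_ , d<) = (+ suc k , + 2 , + suc d) , InG-intro (+ suc k) 2 february , refl
  where
  february : + suc d ℤ.≤ L (+ suc k) (+ 2)
  february with isLeap (+ suc k)
  ... | true  = +≤+ (m≤n⇒m≤1+n d<)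
  ... | false = +≤+ d<
inYear⇒InG k (suc (suc (suc (suc (suc (suc (suc (suc (suc (suc (suc (suc (suc (suc (suc _)))))))))))))) , _) ((_ , m≤14) , _) =
  ⊥-elim (1+n≰n (m+n≤o⇒m≤o 15 m≤14))

day-≺ : ∀ {y p q} → p ≺ q → day y p <ₗ day y q
day-≺ (inj₁ m<m₀) = inj₂ (refl , inj₁ (+<+ m<m₀))
day-≺ (inj₂ (refl , d<d₀)) = inj₂ (refl , inj₂ (refl , +<+ d<d₀))

between⇒≺ : ∀ {y a b y₁ p q} → (y , a , b) ≤ₗ day y₁ p → day y₁ p <ₗ day y q → y₁ ≡ y × p ≺ q
between⇒≺ (inj₁ (inj₁ y<y₁)) (inj₁ y₁<y) = ⊥-elim (<-asym y<y₁ y₁<y)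
between⇒≺ (inj₁ (inj₂ (refl , _))) (inj₁ y<y) = ⊥-elim (<-irrefl refl y<y)
between⇒≺ (inj₂ refl) (inj₁ y<y) = ⊥-elim (<-irrefl refl y<y)
between⇒≺ _ (inj₂ (refl , inj₁ (+<+ m<m₀))) = refl , inj₁ m<m₀
between⇒≺ _ (inj₂ (refl , inj₂ (m≡m₀ , +<+ d<d₀))) = refl , inj₂ (+-injective m≡m₀ , d<d₀)

yearStart≤ₗday : ∀ {y m d} → 3 ℕ.≤ m → (y , + 3 , + 0) ≤ₗ day y (m , d)
yearStart≤ₗday {d = d} 3≤m with m≤n⇒m<n∨m≡n 3≤m | d
... | inj₁ 3<m  | _     = inj₁ (inj₂ (refl , inj₁ (+<+ 3<m)))
... | inj₂ refl | zero  = inj₂ refl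
... | inj₂ refl | suc _ = inj₁ (inj₂ (refl , inj₂ (refl , +<+ z<s)))

epoch≤ₗday : ∀ k {m d} → 3 ℕ.≤ m → (+ 0 , + 3 , + 0) ≤ₗ day (+ k) (m , d)
epoch≤ₗday zero    3≤m = yearStart≤ₗday 3≤m
epoch≤ₗday (suc k) _   = inj₁ (inj₁ (+<+ z<s))

epoch≤ₗ⇒nonNegYear : ∀ {y m d} → (+ 0 , + 3 , + 0) ≤ₗ (y , m , d) → ∃[ k ] y ≡ + k
epoch≤ₗ⇒nonNegYear {+ k} _ = k , refl
epoch≤ₗ⇒nonNegYear { -[1+ _ ]} (inj₁ (inj₁ ()))
epoch≤ₗ⇒nonNegYear { -[1+ _ ]} (inj₁ (inj₂ (() , _)))
epoch≤ₗ⇒nonNegYear { -[1+ _ ]} (inj₂ ())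

inYear⇒InG₀ : ∀ k p → InYear false p → InG₀ (day (+ k) p)
inYear⇒InG₀ k p p∈@((3≤m , _) , _) = inYear⇒InG k p p∈ , epoch≤ₗday k 3≤m

firstDays : ℤ → ℕ → List Date
firstDays y n = applyUpTo (day y ∘ decode) n

firstDays-unique : ∀ y {n} → n ℕ.≤ 366 → Unique (firstDays y n)
firstDays-unique y {n} n≤366 = applyUpTo⁺₁ _ n distinct
  where
  distinct : ∀ {i j} → i ℕ.< j → j ℕ.< n → day y (decode i) ≢ day y (decode j)
  distinct {i} {j} i<j j<n eq =
    ≺-irrefl (subst (_≺ decode j) (day-injective eq) (decode-strictMono i<j (s≤s⁻¹ (<-≤-trans j<n n≤366))))

∈-firstDays⇔ : ∀ k {p₀} → InYear true p₀ → ∀ z →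
  (z ∈ firstDays (+ k) (dayOfYear p₀)) ⇔ (InG₀ z × ((+ k , + 3 , + 0) ≤ₗ z) × (z <ₗ day (+ k) p₀))
∈-firstDays⇔ k {p₀} p₀∈ z = mk⇔ from-index to-index
  where
  from-index : z ∈ firstDays (+ k) (dayOfYear p₀) → InG₀ z × ((+ k , + 3 , + 0) ≤ₗ z) × (z <ₗ day (+ k) p₀)
  from-index z∈ with ∈-applyUpTo⁻ _ z∈
  ... | i , i<N , refl = inYear⇒InG₀ k (decode i) i∈ , yearStart≤ₗday (proj₁ (proj₁ i∈)) , day-≺ i≺p₀
    where
    i∈ : InYear false (decode i)
    i∈ = decode-inYear (<-≤-trans i<N (dayOfYear≤365 p₀∈))
    i≺p₀ : decode i ≺ p₀
    i≺p₀ = subst (decode i ≺_) (decode-dayOfYear p₀∈) (decode-strictMono i<N (dayOfYear≤365 p₀∈))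
  to-index : InG₀ z × ((+ k , + 3 , + 0) ≤ₗ z) × (z <ₗ day (+ k) p₀) → z ∈ firstDays (+ k) (dayOfYear p₀)
  to-index (z∈G₀ , start≤z , z<p₀) with InG₀⇒inYear z∈G₀
  ... | p , p∈ , refl with between⇒≺ start≤z z<p₀
  ... | refl , p≺p₀ = subst (_∈ firstDays (+ k) (dayOfYear p₀)) (cong (day (+ k)) (decode-dayOfYear p∈))
                            (∈-applyUpTo⁺ _ (dayOfYear-strictMono p∈ p₀∈ p≺p₀))

length≡dayOfYear : ∀ k {p₀} → InYear true p₀ → (S : List Date) → Unique S →
  (∀ z → (z ∈ S) ⇔ (InG₀ z × ((+ k , + 3 , + 0) ≤ₗ z) × (z <ₗ day (+ k) p₀))) →
  length S ≡ dayOfYear p₀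
length≡dayOfYear k {p₀} p₀∈ S unique-S S⇔ = begin
  length S                                 ≡⟨ length-unique-⇔ unique-S unique-firstDays S⇔firstDays ⟩
  length (firstDays (+ k) (dayOfYear p₀))  ≡⟨ length-applyUpTo _ (dayOfYear p₀) ⟩
  dayOfYear p₀                             ∎
  where
  open ≡-Reasoning
  unique-firstDays : Unique (firstDays (+ k) (dayOfYear p₀))
  unique-firstDays = firstDays-unique (+ k) (m≤n⇒m≤1+n (dayOfYear≤365 p₀∈))
  S⇔firstDays : ∀ z → (z ∈ S) ⇔ (z ∈ firstDays (+ k) (dayOfYear p₀))
  S⇔firstDays z = ⇔-trans (S⇔ z) (⇔-sym (∈-firstDays⇔ k p₀∈ z))

decodeℤ-dayOfYear : ∀ {n m d} → InYear true (m , d) → n ≡ dayOfYear (m , d) →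
  let n₃ = + 5 * + n + + 461
  in (n₃ / + 153 ≡ + m) × (+ (n₃ % + 153) / + 5 ≡ + d)
decodeℤ-dayOfYear {n} p∈ refl rewrite sym (pos-* 5 n) =
  trans (div-pos-is-/ℕ (+ n₃) 153) (cong (+_ ∘ proj₁) (decode-dayOfYear p∈)) ,
  trans (div-pos-is-/ℕ (+ (n₃ ℕ.% 153)) 5) (cong (+_ ∘ proj₂) (decode-dayOfYear p∈))
  where
  n₃ : ℕ
  n₃ = 5 ℕ.* n ℕ.+ 461

proposition4 : (y₀ m₀ d₀ : ℤ) → InG₀ (y₀ , m₀ , d₀) →
    (S : List Date) → Unique S →
    (∀ z → (z ∈ S) ⇔ (InG₀ z × ((y₀ , + 3 , + 0) ≤ₗ z) × (z <ₗ (y₀ , m₀ , d₀)))) →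
    let n₃ = + 5 * + length S + + 461
    in (n₃ / + 153 ≡ m₀) × (+ (n₃ % + 153) / + 5 ≡ d₀)
proposition4 y₀ m₀ d₀ x₀ S unique-S S⇔ with epoch≤ₗ⇒nonNegYear (proj₂ x₀) | InG₀⇒inYear x₀
... | k , refl | (m , d) , p∈ , refl = decodeℤ-dayOfYear p∈ (length≡dayOfYear k p∈ S unique-S S⇔)
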